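{- For every integer $k\geq 1$, the graph $BC(k)$ is a proper disk graph.
   Context: $BC(1)$ is the graph with a single vertex, and for $k\geq 2$, $BC(k)$ is obtained from two disjoint copies of $BC(k-1)$ by adding one new vertex adjacent to all vertices of both copies. A proper disk graph is the intersection graph of a finite family of closed disks in the plane such that no disk of the family properly contains another disk of the family. -}

module Defs where

open import Level using (0ℓ)
open import Data.Nat using (ℕ; zero; suc; _∸_)
open import Data.Empty using (⊥)
open import Data.Unit using (⊤)
open import Data.Product using (Σ; ∃; _×_; _,_)
open import Relation.Nullary using (¬_)
open import Relation.Binary.PropositionalEquality using (_≡_; _≢_)
open import Relation.Binary.Structures using (IsTotalOrder)
open import Algebra.Structures using (IsCommutativeRing)

-- The real numbers, axiomatised as a complete ordered field
-- (unique up to isomorphism, so any model is ℝ).  The theorem is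
-- quantified over every such model.

record RealField : Set₁ where
  infixl 6 _+_
  infixl 7 _*_
  infix  4 _≤_ _<_
  field
    Carrier : Set
    _+_ _*_ : Carrier → Carrier → Carrier
    -_      : Carrier → Carrier
    0# 1#   : Carrier
    _≤_     : Carrier → Carrier → Set
    isCommutativeRing : IsCommutativeRing _≡_ _+_ _*_ -_ 0# 1#
    0≢1     : 0# ≢ 1#
    inverse : ∀ x → x ≢ 0# → ∃ λ y → x * y ≡ 1#
    isTotalOrder : IsTotalOrder _≡_ _≤_
    +-mono-≤ : ∀ {a b} c → a ≤ b → a + c ≤ b + c
    *-nonneg : ∀ {a b} → 0# ≤ a → 0# ≤ b → 0# ≤ a * b
    complete : (P : Carrier → Set) → ∃ P →
               (∃ λ b → ∀ x → P x → x ≤ b) →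
               ∃ λ s → (∀ x → P x → x ≤ s) ×
                       (∀ b → (∀ x → P x → x ≤ b) → s ≤ b)

  _<_ : Carrier → Carrier → Set
  a < b = (a ≤ b) × (a ≢ b)

  _-_ : Carrier → Carrier → Carrier
  a - b = a + (- b)

  sq : Carrier → Carrier
  sq a = a * a

module Disks (R : RealField) where
  open RealField R

  Point : Set
  Point = Carrier × Carrier

  record Disk : Set where
    constructor disk
    field
      cx cy  : Carrier
      radius : Carrier
      radius-pos : 0# < radius

  _∈D_ : Point → Disk → Set
  (px , py) ∈D disk cx cy r _ = sq (px - cx) + sq (py - cy) ≤ sq r

  _⊆D_ : Disk → Disk → Set
  D ⊆D E = ∀ p → p ∈D D → p ∈D E

  Intersect : Disk → Disk → Set
  Intersect D E = ∃ λ p → (p ∈D D) × (p ∈D E)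

  ProperlyContains : Disk → Disk → Set
  ProperlyContains D E = (E ⊆D D) × ¬ (D ⊆D E)

  SameDisk : Disk → Disk → Set
  SameDisk D E = (D ⊆D E) × (E ⊆D D)

record Graph : Set₁ where
  field
    V : Set
    E : V → V → Set

IsProperDiskGraph : RealField → Graph → Set
IsProperDiskGraph R G = ∃ λ (d : V → Disk) →
    (∀ u v → u ≢ v → ¬ SameDisk (d u) (d v)) ×
    (∀ u v → u ≢ v → (E u v → Intersect (d u) (d v)) × (Intersect (d u) (d v) → E u v)) ×
    (∀ u v → ¬ ProperlyContains (d u) (d v))
  where open Graph G
        open Disks R

-- BC(k).  BCV n is the vertex set of BC(n+1):
--   root  : the vertex added last (for n = 0, the single vertex),
--   left x / right x : vertex x of the first / second copy of BC(n).

data BCV : ℕ → Set where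
  root  : ∀ {n} → BCV n
  left  : ∀ {n} → BCV n → BCV (suc n)
  right : ∀ {n} → BCV n → BCV (suc n)

BCAdj : ∀ {n} → BCV n → BCV n → Set
BCAdj root      root      = ⊥
BCAdj root      (left _)  = ⊤
BCAdj root      (right _) = ⊤
BCAdj (left _)  root      = ⊤
BCAdj (right _) root      = ⊤
BCAdj (left x)  (left y)  = BCAdj x y
BCAdj (right x) (right y) = BCAdj x y
BCAdj (left _)  (right _) = ⊥
BCAdj (right _) (left _)  = ⊥

-- BC k for k ≥ 1 (the value at k = 0 is irrelevant; the theorem assumes k ≥ 1).
BC : ℕ → Graph
BC k = record { V = BCV (k ∸ 1) ; E = BCAdj }

-- Each vertex v of BC(n+1) gets the disk tangent to the x-axis from above at the
-- integer point (foot v, 0), with an integer radius that depends only on the level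
-- of v (the k for which v is the apex of a copy of BC(k+1) inside BC(n+1)).  The
-- feet are pairwise distinct and a disk tangent to the x-axis meets it only at its
-- foot, so no disk contains the foot of another: no disk contains another.  In
-- BC(m+2) the two copies of BC(m+1) are laid out side by side with disjoint
-- x-extents, so disks from different copies are disjoint.  The apex disk is so
-- large that its chord on the line y = 1 covers the feet of both copies, and every
-- disk contains the point at height 1 above its own foot, so the apex disk meets
-- all the others.
module Submission where

open import Defs
open import Algebra using (CommutativeRing)
open import Data.Nat as ℕ using (ℕ; zero; suc; z≤n; s≤s; ∣_-_∣)
import Data.Nat.Properties as ℕ
open import Data.Product using (_×_; _,_; proj₁; proj₂; map₂; swap)
open import Data.Sum as Sum using (_⊎_; inj₁; inj₂; [_,_])
open import Data.Empty using (⊥-elim)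
open import Function using (_∘_; id)
open import Relation.Binary.Bundles using (TotalOrder)
open import Relation.Nullary using (¬_; yes; no; ¬¬-map)
open import Relation.Binary.PropositionalEquality using (_≡_; _≢_; refl; sym; trans; cong; cong₂; subst; subst₂)

module BCLayout where

  open import Data.Nat using (_+_; _*_; _∸_; _≤_; _<_)
  open import Data.Nat.Properties
  open import Data.Unit using (tt)

  -- radius (suc m) = reach (suc m) ² + 1, so reach (suc m) ² ≤ 2 · radius (suc m) − 1:
  -- the line y = 1 cuts a chord of half-width reach (suc m) out of the disk of that
  -- radius tangent to the x-axis (reach-chord).
  radius     : ℕ → ℕ
  leftOffset : ℕ → ℕ

  span : ℕ → ℕ
  span h = 2 * radius h

  radius zero    = 1
  radius (suc m) = leftOffset m + suc (span m)

  leftOffset m = suc (span m * suc (span m))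

  reach : ℕ → ℕ
  reach zero    = 0
  reach (suc m) = suc (span m)

  rightOffset : ℕ → ℕ
  rightOffset m = suc (radius (suc m))

  -- The disk of v will have centre (foot v, radius (level v)).
  level : ∀ {n} → BCV n → ℕ
  level {n} root  = n
  level (left v)  = level v
  level (right v) = level v

  foot : ∀ {n} → BCV n → ℕ
  foot {n}     root      = radius n
  foot {suc m} (left v)  = leftOffset m + foot v
  foot {suc m} (right v) = rightOffset m + foot v

  radius-pos : ∀ h → 0 < radius h
  radius-pos zero    = s≤s z≤n
  radius-pos (suc m) = s≤s z≤n

  reach≤radius : ∀ h → reach h ≤ radius h
  reach≤radius zero    = z≤n
  reach≤radius (suc m) = m≤n+m (reach (suc m)) (leftOffset m)

  reach-chord : ∀ h {d} → d ≤ reach h →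
                d * d + ∣ 1 - radius h ∣ * ∣ 1 - radius h ∣ ≤ radius h * radius h
  reach-chord zero    z≤n = z≤n
  reach-chord (suc m) {d} d≤c = begin
    d * d + K * K     ≤⟨ +-monoˡ-≤ (K * K) (*-mono-≤ d≤c d≤c) ⟩
    c * c + K * K     ≡⟨ cong (_+ K * K) (+-comm c (span m * c)) ⟩
    K + K * K         ≤⟨ +-monoʳ-≤ K (*-monoʳ-≤ K (n≤1+n K)) ⟩
    K + K * suc K     ≤⟨ n≤1+n _ ⟩
    suc K * suc K     ∎
    where
    open ≤-Reasoning
    c = reach (suc m)
    K = span m * c + c

  radius≤foot : ∀ {n} (v : BCV n) → radius (level v) ≤ foot v
  radius≤foot root              = ≤-refl
  radius≤foot {suc m} (left v)  = ≤-trans (radius≤foot v) (m≤n+m _ (leftOffset m))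
  radius≤foot {suc m} (right v) = ≤-trans (radius≤foot v) (m≤n+m _ (rightOffset m))

  foot+radius≤span : ∀ {n} (v : BCV n) → foot v + radius (level v) ≤ span n
  foot+radius≤span {n} root = ≤-reflexive (cong (radius n +_) (sym (+-identityʳ (radius n))))
  foot+radius≤span {suc m} (left v) = begin
    leftOffset m + foot v + radius (level v)   ≡⟨ +-assoc (leftOffset m) _ _ ⟩
    leftOffset m + (foot v + radius (level v)) ≤⟨ +-monoʳ-≤ (leftOffset m) (foot+radius≤span v) ⟩
    leftOffset m + span m                      ≤⟨ +-monoʳ-≤ (leftOffset m) (n≤1+n _) ⟩
    radius (suc m)                             ≤⟨ m≤m+n _ _ ⟩
    span (suc m)                               ∎
    where open ≤-Reasoning
  foot+radius≤span {suc m} (right v) = begin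
    rightOffset m + foot v + radius (level v)   ≡⟨ +-assoc (rightOffset m) _ _ ⟩
    rightOffset m + (foot v + radius (level v)) ≤⟨ +-monoʳ-≤ (rightOffset m) (foot+radius≤span v) ⟩
    rightOffset m + span m                      ≡⟨ +-suc (radius (suc m)) (span m) ⟨
    radius (suc m) + reach (suc m)              ≤⟨ +-monoʳ-≤ (radius (suc m)) (reach≤radius (suc m)) ⟩
    radius (suc m) + radius (suc m)             ≡⟨ cong (radius (suc m) +_) (+-identityʳ _) ⟨
    span (suc m)                                ∎
    where open ≤-Reasoning

  foot≤span : ∀ {n} (v : BCV n) → foot v ≤ span n
  foot≤span v = ≤-trans (m≤m+n (foot v) _) (foot+radius≤span v)

  foot-left<radius : ∀ {m} (v : BCV m) → foot (left v) < radius (suc m)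
  foot-left<radius {m} v = +-monoʳ-< (leftOffset m) (s≤s (foot≤span v))

  radius<foot-right : ∀ {m} (v : BCV m) → radius (suc m) < foot (right v)
  radius<foot-right {m} v = s≤s (m≤m+n (radius (suc m)) (foot v))

  foot-injective : ∀ {n} (u v : BCV n) → foot u ≡ foot v → u ≡ v
  foot-injective root      root      _  = refl
  foot-injective root      (left v)  eq = ⊥-elim (<-irrefl (sym eq) (foot-left<radius v))
  foot-injective root      (right v) eq = ⊥-elim (<-irrefl eq (radius<foot-right v))
  foot-injective (left u)  root      eq = ⊥-elim (<-irrefl eq (foot-left<radius u))
  foot-injective (right u) root      eq = ⊥-elim (<-irrefl (sym eq) (radius<foot-right u))
  foot-injective (left u)  (right v) eq = ⊥-elim (<-irrefl eq (<-trans (foot-left<radius u) (radius<foot-right v)))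
  foot-injective (right u) (left v)  eq = ⊥-elim (<-irrefl (sym eq) (<-trans (foot-left<radius v) (radius<foot-right u)))
  foot-injective {suc m} (left u)  (left v)  eq = cong left  (foot-injective u v (+-cancelˡ-≡ (leftOffset m) _ _ eq))
  foot-injective {suc m} (right u) (right v) eq = cong right (foot-injective u v (+-cancelˡ-≡ (rightOffset m) _ _ eq))

  -- The chord of the disk of u on the line y = 1 covers the point above the foot of v.
  Reaches : ∀ {n} → BCV n → BCV n → Set
  Reaches u v = ∣ foot u - foot v ∣ ≤ reach (level u)

  reaches-refl : ∀ {n} (v : BCV n) → Reaches v v
  reaches-refl v = subst (_≤ reach (level v)) (sym (∣n-n∣≡0 (foot v))) z≤n

  -- The x-extent of the disk of u lies strictly to the left of that of v.
  Apart : ∀ {n} → BCV n → BCV n → Set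
  Apart u v = foot u + radius (level u) + radius (level v) < foot v

  ∣-∣-shift : ∀ k {a b r} → ∣ a - b ∣ ≤ r → ∣ k + a - k + b ∣ ≤ r
  ∣-∣-shift k {a} {b} = subst (_≤ _) (sym (∣m+n-m+o∣≡∣n-o∣ k a b))

  <-shift : ∀ k {a b c d} → a + b + c < d → k + a + b + c < k + d
  <-shift k {a} {b} {c} {d} a+b+c<d =
    subst (_< k + d) (trans (sym (+-assoc k (a + b) c)) (cong (_+ c) (sym (+-assoc k a b))))
          (+-monoʳ-< k a+b+c<d)

  root-reaches-left : ∀ {m} (v : BCV m) → Reaches root (left v)
  root-reaches-left {m} v = begin
    ∣ leftOffset m + c - leftOffset m + foot v ∣ ≡⟨ ∣m+n-m+o∣≡∣n-o∣ (leftOffset m) c (foot v) ⟩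
    ∣ c - foot v ∣                               ≡⟨ m≤n⇒∣n-m∣≡n∸m (m≤n⇒m≤1+n (foot≤span v)) ⟩
    c ∸ foot v                                   ≤⟨ m∸n≤m c (foot v) ⟩
    c                                            ∎
    where
    open ≤-Reasoning
    c = reach (suc m)

  root-reaches-right : ∀ {m} (v : BCV m) → Reaches root (right v)
  root-reaches-right {m} v = begin
    ∣ ρ - suc ρ + foot v ∣   ≡⟨ cong (λ x → ∣ ρ - x ∣) (+-suc ρ (foot v)) ⟨
    ∣ ρ - ρ + suc (foot v) ∣ ≡⟨ ∣m-m+n∣≡n ρ (suc (foot v)) ⟩
    suc (foot v)             ≤⟨ s≤s (foot≤span v) ⟩
    reach (suc m)            ∎
    where
    open ≤-Reasoning
    ρ = radius (suc m)

  adjacent⇒reaches : ∀ {n} (u v : BCV n) → BCAdj u v → Reaches u v ⊎ Reaches v u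
  adjacent⇒reaches root      (left v)  _ = inj₁ (root-reaches-left v)
  adjacent⇒reaches root      (right v) _ = inj₁ (root-reaches-right v)
  adjacent⇒reaches (left u)  root      _ = inj₂ (root-reaches-left u)
  adjacent⇒reaches (right u) root      _ = inj₂ (root-reaches-right u)
  adjacent⇒reaches {suc m} (left u)  (left v)  uv =
    Sum.map (∣-∣-shift (leftOffset m)) (∣-∣-shift (leftOffset m)) (adjacent⇒reaches u v uv)
  adjacent⇒reaches {suc m} (right u) (right v) uv =
    Sum.map (∣-∣-shift (rightOffset m)) (∣-∣-shift (rightOffset m)) (adjacent⇒reaches u v uv)

  copies-apart : ∀ {m} (u v : BCV m) → Apart (left u) (right v)
  copies-apart {m} u v = begin-strict
    leftOffset m + foot u + radius (level u) + radius (level v)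
      ≡⟨ cong (_+ radius (level v)) (+-assoc (leftOffset m) _ _) ⟩
    leftOffset m + (foot u + radius (level u)) + radius (level v)
      ≤⟨ +-monoˡ-≤ (radius (level v)) (+-monoʳ-≤ (leftOffset m) (foot+radius≤span u)) ⟩
    leftOffset m + span m + radius (level v)
      <⟨ +-monoˡ-< (radius (level v)) (+-monoʳ-< (leftOffset m) (n<1+n (span m))) ⟩
    radius (suc m) + radius (level v)
      ≤⟨ +-monoʳ-≤ (radius (suc m)) (radius≤foot v) ⟩
    radius (suc m) + foot v
      <⟨ n<1+n _ ⟩
    foot (right v) ∎
    where open ≤-Reasoning

  adjacent-or-apart : ∀ {n} (u v : BCV n) → u ≢ v → BCAdj u v ⊎ Apart u v ⊎ Apart v u
  adjacent-or-apart root      root      u≢v = ⊥-elim (u≢v refl)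
  adjacent-or-apart root      (left _)  _   = inj₁ tt
  adjacent-or-apart root      (right _) _   = inj₁ tt
  adjacent-or-apart (left _)  root      _   = inj₁ tt
  adjacent-or-apart (right _) root      _   = inj₁ tt
  adjacent-or-apart (left u)  (right v) _   = inj₂ (inj₁ (copies-apart u v))
  adjacent-or-apart (right u) (left v)  _   = inj₂ (inj₂ (copies-apart v u))
  adjacent-or-apart {suc m} (left u)  (left v)  u≢v =
    Sum.map₂ (Sum.map (<-shift (leftOffset m)) (<-shift (leftOffset m)))
             (adjacent-or-apart u v (u≢v ∘ cong left))
  adjacent-or-apart {suc m} (right u) (right v) u≢v =
    Sum.map₂ (Sum.map (<-shift (rightOffset m)) (<-shift (rightOffset m)))
             (adjacent-or-apart u v (u≢v ∘ cong right))

module OrderedFieldProperties (R : RealField) where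

  open RealField R hiding (isTotalOrder) renaming (+-mono-≤ to +-monoˡ-≤)

  commutativeRing : CommutativeRing _ _
  commutativeRing = record { isCommutativeRing = isCommutativeRing }

  totalOrder : TotalOrder _ _ _
  totalOrder = record { isTotalOrder = RealField.isTotalOrder R }

  open CommutativeRing commutativeRing
    using ( +-comm; +-identityˡ; +-identityʳ; -‿inverseʳ; *-comm; *-identityˡ; *-assoc; zeroʳ
          ; ring; +-group; +-abelianGroup)
  open import Algebra.Properties.Ring ring using (-‿distribˡ-*; -‿distribʳ-*; x[y-z]≈xy-xz)
  open import Algebra.Properties.Group +-group
    using (//-rightDividesˡ; //-rightDividesʳ; x∙y⁻¹≈ε⇒x≈y; x≈y⇒x∙y⁻¹≈ε; ⁻¹-involutive)
  open import Algebra.Properties.AbelianGroup +-abelianGroup using (⁻¹-anti-homo‿-)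
  open TotalOrder totalOrder using (poset; total) renaming (refl to ≤-refl; trans to ≤-trans)
  open import Relation.Binary.Properties.TotalOrder totalOrder using (≰⇒>; <⇒≱)
  open import Relation.Binary.Reasoning.PartialOrder poset

  +-monoʳ-≤ : ∀ {a b} c → a ≤ b → c + a ≤ c + b
  +-monoʳ-≤ {a} {b} c a≤b = subst₂ _≤_ (+-comm a c) (+-comm b c) (+-monoˡ-≤ c a≤b)

  +-mono-≤ : ∀ {a b c d} → a ≤ b → c ≤ d → a + c ≤ b + d
  +-mono-≤ {b = b} {c} a≤b c≤d = ≤-trans (+-monoˡ-≤ c a≤b) (+-monoʳ-≤ b c≤d)

  neg*neg : ∀ x → - x * - x ≡ x * x
  neg*neg x = begin-equality
    - x * - x       ≡⟨ -‿distribˡ-* x (- x) ⟨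
    - (x * - x)     ≡⟨ cong -_ (-‿distribʳ-* x x) ⟨
    - - (x * x)     ≡⟨ ⁻¹-involutive (x * x) ⟩
    x * x           ∎

  ≤0⇒0≤- : ∀ {a} → a ≤ 0# → 0# ≤ - a
  ≤0⇒0≤- {a} a≤0 = subst₂ _≤_ (-‿inverseʳ a) (+-identityˡ (- a)) (+-monoˡ-≤ (- a) a≤0)

  sq-nonneg : ∀ x → 0# ≤ sq x
  sq-nonneg x with total 0# x
  ... | inj₁ 0≤x = *-nonneg 0≤x 0≤x
  ... | inj₂ x≤0 = subst (0# ≤_) (neg*neg x) (*-nonneg (≤0⇒0≤- x≤0) (≤0⇒0≤- x≤0))

  0≤1 : 0# ≤ 1#
  0≤1 = subst (0# ≤_) (*-identityˡ 1#) (sq-nonneg 1#)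

  sq-sub-comm : ∀ x y → sq (x - y) ≡ sq (y - x)
  sq-sub-comm x y = begin-equality
    sq (x - y)       ≡⟨ cong sq (⁻¹-anti-homo‿- y x) ⟨
    sq (- (y - x))   ≡⟨ neg*neg (y - x) ⟩
    sq (y - x)       ∎

  x≤x+y : ∀ {x y} → 0# ≤ y → x ≤ x + y
  x≤x+y {x} {y} 0≤y = subst (_≤ x + y) (+-identityʳ x) (+-monoʳ-≤ x 0≤y)

  x<y+x : ∀ {x y} → 0# < y → x < y + x
  x<y+x {x} {y} (0≤y , 0≢y) =
    subst (_≤ y + x) (+-identityˡ x) (+-monoˡ-≤ x 0≤y) ,
    λ x≡y+x → 0≢y (sym (begin-equality
      y               ≡⟨ //-rightDividesʳ x y ⟨
      (y + x) - x     ≡⟨ cong (_- x) x≡y+x ⟨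
      x - x           ≡⟨ -‿inverseʳ x ⟩
      0#              ∎))

  x-y≤z⇒x≤y+z : ∀ {x y z} → x - y ≤ z → x ≤ y + z
  x-y≤z⇒x≤y+z {x} {y} {z} h = subst₂ _≤_ (//-rightDividesˡ y x) (+-comm z y) (+-monoˡ-≤ y h)

  ≤⇒0≤- : ∀ {a b} → a ≤ b → 0# ≤ b - a
  ≤⇒0≤- {a} {b} a≤b = subst (_≤ b - a) (-‿inverseʳ a) (+-monoˡ-≤ (- a) a≤b)

  0≤-⇒≤ : ∀ {a b} → 0# ≤ b - a → a ≤ b
  0≤-⇒≤ {a} {b} h = subst₂ _≤_ (+-identityˡ a) (//-rightDividesˡ a b) (+-monoˡ-≤ a h)

  <⇒0<- : ∀ {a b} → a < b → 0# < b - a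
  <⇒0<- {a} {b} (a≤b , a≢b) =
    ≤⇒0≤- a≤b , λ 0≡b-a → a≢b (sym (x∙y⁻¹≈ε⇒x≈y b a (sym 0≡b-a)))

  0<-⇒< : ∀ {a b} → 0# < b - a → a < b
  0<-⇒< (h , 0≢b-a) = 0≤-⇒≤ h , λ a≡b → 0≢b-a (sym (x≈y⇒x∙y⁻¹≈ε (sym a≡b)))

  x*y≡0⇒y≡0 : ∀ {x y} → x ≢ 0# → x * y ≡ 0# → y ≡ 0#
  x*y≡0⇒y≡0 {x} {y} x≢0 xy≡0 = begin-equality
    y                ≡⟨ *-identityˡ y ⟨
    1# * y           ≡⟨ cong (_* y) (trans (*-comm x⁻¹ x) x*x⁻¹≡1) ⟨
    x⁻¹ * x * y      ≡⟨ *-assoc x⁻¹ x y ⟩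
    x⁻¹ * (x * y)    ≡⟨ cong (x⁻¹ *_) xy≡0 ⟩
    x⁻¹ * 0#         ≡⟨ zeroʳ x⁻¹ ⟩
    0#               ∎
    where
    x⁻¹ = proj₁ (inverse x x≢0)
    x*x⁻¹≡1 = proj₂ (inverse x x≢0)

  *-pos : ∀ {x y} → 0# < x → 0# < y → 0# < x * y
  *-pos (0≤x , 0≢x) (0≤y , 0≢y) =
    *-nonneg 0≤x 0≤y , λ 0≡xy → 0≢y (sym (x*y≡0⇒y≡0 (0≢x ∘ sym) (sym 0≡xy)))

  *-monoʳ-≤ : ∀ {a b} c → 0# ≤ c → a ≤ b → c * a ≤ c * b
  *-monoʳ-≤ {a} {b} c 0≤c a≤b =
    0≤-⇒≤ (subst (0# ≤_) (x[y-z]≈xy-xz c b a) (*-nonneg 0≤c (≤⇒0≤- a≤b)))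

  *-monoʳ-< : ∀ {a b} c → 0# < c → a < b → c * a < c * b
  *-monoʳ-< {a} {b} c 0<c a<b =
    0<-⇒< (subst (0# <_) (x[y-z]≈xy-xz c b a) (*-pos 0<c (<⇒0<- a<b)))

  sq-mono-< : ∀ {a b} → 0# ≤ a → a < b → sq a < sq b
  sq-mono-< {a} {b} 0≤a a<b = begin-strict
    a * a   ≤⟨ *-monoʳ-≤ a 0≤a (proj₁ a<b) ⟩
    a * b   ≡⟨ *-comm a b ⟩
    b * a   <⟨ *-monoʳ-< b (begin-strict 0# ≤⟨ 0≤a ⟩ a <⟨ a<b ⟩ b ∎) a<b ⟩
    b * b   ∎

  -- Without decidable equality on the carrier, a ≤ b is only available doubly negated.
  sq≤sq⇒¬¬≤ : ∀ {a b} → 0# ≤ b → sq a ≤ sq b → ¬ ¬ (a ≤ b)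
  sq≤sq⇒¬¬≤ 0≤b sq≤ a≰b = <⇒≱ (sq-mono-< 0≤b (≰⇒> a≰b)) sq≤

module DiskProperties (R : RealField) where

  open RealField R hiding (isTotalOrder) renaming (+-mono-≤ to +-monoˡ-≤)
  open OrderedFieldProperties R
  open Disks R
  open CommutativeRing commutativeRing using (+-identityˡ; semiring; +-group)
  open import Algebra.Properties.Semiring.Mult semiring using (×-homo-+; ×1-homo-*) renaming (_×_ to _·_)
  open import Algebra.Properties.Group +-group using (//-rightDividesʳ)
  open TotalOrder totalOrder using (poset) renaming (refl to ≤-refl; trans to ≤-trans)
  open import Relation.Binary.Properties.TotalOrder totalOrder using (<⇒≱)
  open import Relation.Binary.Reasoning.PartialOrder poset

  ι : ℕ → Carrier
  ι n = n · 1#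

  ι-+ : ∀ m n → ι (m ℕ.+ n) ≡ ι m + ι n
  ι-+ = ×-homo-+ 1#

  ι-* : ∀ m n → ι (m ℕ.* n) ≡ ι m * ι n
  ι-* = ×1-homo-*

  ι-nonneg : ∀ n → 0# ≤ ι n
  ι-nonneg zero    = ≤-refl
  ι-nonneg (suc n) = subst (_≤ ι (suc n)) (+-identityˡ 0#) (+-mono-≤ 0≤1 (ι-nonneg n))

  ι-mono-≤ : ∀ {m n} → m ℕ.≤ n → ι m ≤ ι n
  ι-mono-≤ {n = n} z≤n = ι-nonneg n
  ι-mono-≤ (s≤s m≤n)   = +-monoʳ-≤ 1# (ι-mono-≤ m≤n)

  ι-mono-< : ∀ {m n} → m ℕ.< n → ι m < ι n
  ι-mono-< {m} {n} m<n = begin-strict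
    ι m         <⟨ x<y+x (0≤1 , 0≢1) ⟩
    ι (suc m)   ≤⟨ ι-mono-≤ m<n ⟩
    ι n         ∎

  ι-cancel-≤ : ∀ {m n} → ι m ≤ ι n → m ℕ.≤ n
  ι-cancel-≤ {m} {n} ιm≤ιn with m ℕ.≤? n
  ... | yes m≤n = m≤n
  ... | no  m≰n = ⊥-elim (<⇒≱ (ι-mono-< (ℕ.≰⇒> m≰n)) ιm≤ιn)

  ι-∸ : ∀ {m n} → n ℕ.≤ m → ι m - ι n ≡ ι (m ℕ.∸ n)
  ι-∸ {m} {n} n≤m = begin-equality
    ι m - ι n                      ≡⟨ cong (λ k → ι k - ι n) (ℕ.m∸n+n≡m n≤m) ⟨
    ι (m ℕ.∸ n ℕ.+ n) - ι n        ≡⟨ cong (_- ι n) (ι-+ (m ℕ.∸ n) n) ⟩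
    (ι (m ℕ.∸ n) + ι n) - ι n      ≡⟨ //-rightDividesʳ (ι n) (ι (m ℕ.∸ n)) ⟩
    ι (m ℕ.∸ n)                    ∎

  sq-ι-sub-≥ : ∀ {m n} → n ℕ.≤ m → sq (ι m - ι n) ≡ ι (∣ m - n ∣ ℕ.* ∣ m - n ∣)
  sq-ι-sub-≥ {m} {n} n≤m = begin-equality
    sq (ι m - ι n)                ≡⟨ cong sq (ι-∸ n≤m) ⟩
    sq (ι (m ℕ.∸ n))              ≡⟨ ι-* (m ℕ.∸ n) (m ℕ.∸ n) ⟨
    ι ((m ℕ.∸ n) ℕ.* (m ℕ.∸ n))   ≡⟨ cong (λ d → ι (d ℕ.* d)) (ℕ.m≤n⇒∣n-m∣≡n∸m n≤m) ⟨
    ι (∣ m - n ∣ ℕ.* ∣ m - n ∣)   ∎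

  sq-ι-sub : ∀ m n → sq (ι m - ι n) ≡ ι (∣ m - n ∣ ℕ.* ∣ m - n ∣)
  sq-ι-sub m n with ℕ.≤-total n m
  ... | inj₁ n≤m = sq-ι-sub-≥ n≤m
  ... | inj₂ m≤n = begin-equality
    sq (ι m - ι n)                ≡⟨ sq-sub-comm (ι m) (ι n) ⟩
    sq (ι n - ι m)                ≡⟨ sq-ι-sub-≥ m≤n ⟩
    ι (∣ n - m ∣ ℕ.* ∣ n - m ∣)   ≡⟨ cong (λ d → ι (d ℕ.* d)) (ℕ.∣-∣-comm n m) ⟩
    ι (∣ m - n ∣ ℕ.* ∣ m - n ∣)   ∎

  sqDist : ℕ × ℕ → ℕ × ℕ → ℕ
  sqDist (x , y) (x′ , y′) = ∣ x - x′ ∣ ℕ.* ∣ x - x′ ∣ ℕ.+ ∣ y - y′ ∣ ℕ.* ∣ y - y′ ∣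

  ι-sqDist : ∀ x y cx cy → sq (ι x - ι cx) + sq (ι y - ι cy) ≡ ι (sqDist (x , y) (cx , cy))
  ι-sqDist x y cx cy =
    trans (cong₂ _+_ (sq-ι-sub x cx) (sq-ι-sub y cy))
          (sym (ι-+ (∣ x - cx ∣ ℕ.* ∣ x - cx ∣) (∣ y - cy ∣ ℕ.* ∣ y - cy ∣)))

  latticeDisk : (cx cy r : ℕ) → 0 ℕ.< r → Disk
  latticeDisk cx cy r 0<r = disk (ι cx) (ι cy) (ι r) (ι-mono-< 0<r)

  ∈latticeDisk : ∀ x y cx cy r (0<r : 0 ℕ.< r) → sqDist (x , y) (cx , cy) ℕ.≤ r ℕ.* r →
                 (ι x , ι y) ∈D latticeDisk cx cy r 0<r
  ∈latticeDisk x y cx cy r _ d≤r² =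
    subst₂ _≤_ (sym (ι-sqDist x y cx cy)) (ι-* r r) (ι-mono-≤ d≤r²)

  ∉latticeDisk : ∀ x y cx cy r (0<r : 0 ℕ.< r) → r ℕ.* r ℕ.< sqDist (x , y) (cx , cy) →
                 ¬ ((ι x , ι y) ∈D latticeDisk cx cy r 0<r)
  ∉latticeDisk x y cx cy r _ r²<d p∈D =
    ℕ.<⇒≱ r²<d (ι-cancel-≤ (subst₂ _≤_ (ι-sqDist x y cx cy) (sym (ι-* r r)) p∈D))

  ∈D⇒¬¬x≤cx+r : ∀ {x y} D → (x , y) ∈D D → ¬ ¬ (x ≤ Disk.cx D + Disk.radius D)
  ∈D⇒¬¬x≤cx+r {x} (disk cx cy r (0≤r , _)) p∈D =
    ¬¬-map x-y≤z⇒x≤y+z (sq≤sq⇒¬¬≤ 0≤r (≤-trans (x≤x+y (sq-nonneg _)) p∈D))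

  ∈D⇒¬¬cx≤x+r : ∀ {x y} D → (x , y) ∈D D → ¬ ¬ (Disk.cx D ≤ x + Disk.radius D)
  ∈D⇒¬¬cx≤x+r {x} {y} (disk cx cy r (0≤r , _)) p∈D =
    ¬¬-map x-y≤z⇒x≤y+z (sq≤sq⇒¬¬≤ 0≤r (≤-trans (x≤x+y (sq-nonneg _))
      (subst (λ s → s + sq (y - cy) ≤ sq r) (sq-sub-comm x cx) p∈D)))

  intersect-sym : ∀ D E → Intersect D E → Intersect E D
  intersect-sym _ _ = map₂ swap

  apart⇒disjoint : ∀ D E → Disk.cx D + Disk.radius D + Disk.radius E < Disk.cx E → ¬ Intersect D E
  apart⇒disjoint D E apart ((x , y) , p∈D , p∈E) =
    ∈D⇒¬¬x≤cx+r D p∈D λ x≤cx+r → ∈D⇒¬¬cx≤x+r E p∈E λ cx≤x+r →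
      <⇒≱ apart (begin
        Disk.cx E                                  ≤⟨ cx≤x+r ⟩
        x + Disk.radius E                          ≤⟨ +-monoˡ-≤ (Disk.radius E) x≤cx+r ⟩
        Disk.cx D + Disk.radius D + Disk.radius E  ∎)

module BCDisks (R : RealField) where

  open BCLayout
  open RealField R using (_+_; _<_)
  open Disks R
  open DiskProperties R

  bcDisk : ∀ {n} → BCV n → Disk
  bcDisk v = latticeDisk (foot v) (radius (level v)) (radius (level v)) (radius-pos (level v))

  foot∈bcDisk : ∀ {n} (v : BCV n) → (ι (foot v) , ι 0) ∈D bcDisk v
  foot∈bcDisk v = ∈latticeDisk (foot v) 0 (foot v) r r (radius-pos (level v))
    (ℕ.≤-reflexive (cong (λ d → d ℕ.* d ℕ.+ r ℕ.* r) (ℕ.∣n-n∣≡0 (foot v))))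
    where r = radius (level v)

  foot∉bcDisk : ∀ {n} (u v : BCV n) → u ≢ v → ¬ ((ι (foot v) , ι 0) ∈D bcDisk u)
  foot∉bcDisk u v u≢v =
    ∉latticeDisk (foot v) 0 (foot u) r r (radius-pos (level u)) (ℕ.m<n+m (r ℕ.* r) (ℕ.n≢0⇒n>0 d²≢0))
    where
    r = radius (level u)
    d = ∣ foot v - foot u ∣
    d²≢0 : d ℕ.* d ≢ 0
    d²≢0 d²≡0 =
      u≢v (foot-injective u v (sym (ℕ.∣m-n∣≡0⇒m≡n ([ id , id ] (ℕ.m*n≡0⇒m≡0∨n≡0 d d²≡0)))))

  bcDisk-⊈ : ∀ {n} (u v : BCV n) → u ≢ v → ¬ (bcDisk v ⊆D bcDisk u)
  bcDisk-⊈ u v u≢v v⊆u = foot∉bcDisk u v u≢v (v⊆u _ (foot∈bcDisk v))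

  reaches⇒∈bcDisk : ∀ {n} (u v : BCV n) → Reaches u v → (ι (foot v) , ι 1) ∈D bcDisk u
  reaches⇒∈bcDisk u v u↝v = ∈latticeDisk (foot v) 1 (foot u) r r (radius-pos (level u))
    (subst (λ d → d ℕ.* d ℕ.+ ∣ 1 - r ∣ ℕ.* ∣ 1 - r ∣ ℕ.≤ r ℕ.* r) (ℕ.∣-∣-comm (foot u) (foot v))
           (reach-chord (level u) u↝v))
    where r = radius (level u)

  reaches⇒intersect : ∀ {n} (u v : BCV n) → Reaches u v → Intersect (bcDisk u) (bcDisk v)
  reaches⇒intersect u v u↝v =
    (ι (foot v) , ι 1) , reaches⇒∈bcDisk u v u↝v , reaches⇒∈bcDisk v v (reaches-refl v)

  apart⇒bcDisjoint : ∀ {n} (u v : BCV n) → Apart u v → ¬ Intersect (bcDisk u) (bcDisk v)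
  apart⇒bcDisjoint u v u⋯v = apart⇒disjoint (bcDisk u) (bcDisk v)
    (subst (_< ι (foot v)) (trans (ι-+ (foot u ℕ.+ ru) rv) (cong (_+ ι rv) (ι-+ (foot u) ru))) (ι-mono-< u⋯v))
    where
    ru = radius (level u)
    rv = radius (level v)

  adjacent⇒intersect : ∀ {n} (u v : BCV n) → BCAdj u v → Intersect (bcDisk u) (bcDisk v)
  adjacent⇒intersect u v uv =
    [ reaches⇒intersect u v , intersect-sym (bcDisk v) (bcDisk u) ∘ reaches⇒intersect v u ] (adjacent⇒reaches u v uv)

  intersect⇒adjacent : ∀ {n} (u v : BCV n) → u ≢ v → Intersect (bcDisk u) (bcDisk v) → BCAdj u v
  intersect⇒adjacent u v u≢v meet with adjacent-or-apart u v u≢v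
  ... | inj₁ uv         = uv
  ... | inj₂ (inj₁ u⋯v) = ⊥-elim (apart⇒bcDisjoint u v u⋯v meet)
  ... | inj₂ (inj₂ v⋯u) = ⊥-elim (apart⇒bcDisjoint v u v⋯u (intersect-sym (bcDisk u) (bcDisk v) meet))

  bcDisk-notProperlyContains : ∀ {n} (u v : BCV n) → ¬ ProperlyContains (bcDisk u) (bcDisk v)
  bcDisk-notProperlyContains u v (v⊆u , u⊈v) =
    (λ u≢v → bcDisk-⊈ u v u≢v v⊆u) (λ { refl → u⊈v (λ _ p∈u → p∈u) })

  bc-isProperDiskGraph : ∀ n → IsProperDiskGraph R (BC (suc n))
  bc-isProperDiskGraph n =
    bcDisk ,
    (λ u v u≢v (_ , v⊆u) → bcDisk-⊈ u v u≢v v⊆u) ,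
    (λ u v u≢v → adjacent⇒intersect u v , intersect⇒adjacent u v u≢v) ,
    bcDisk-notProperlyContains

open import Data.Nat using (_≤_)

theorem15 : (R : RealField) → (k : ℕ) → 1 ≤ k → IsProperDiskGraph R (BC k)
theorem15 R zero    ()
theorem15 R (suc n) _ = BCDisks.bc-isProperDiskGraph R n
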